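{- Let $T$ be a $\{1,3\}$-tree and let $H$ be a collection of pairwise vertex-disjoint leaf-paths in $T$. Then $\frac12\mathbbm{1}_H$ is a vertex of $\mathcal{P}_T$.
   Context: A $\{1,3\}$-tree is a finite tree all of whose nodes have degree $1$ (leaves) or $3$ (internal nodes). A leaf-edge is an edge incident with a leaf; a leaf-path is a path in $T$ whose two extreme edges are leaf-edges (a single edge joining two leaves is a leaf-path). $\mathbbm{1}_H\in\{0,1\}^E$ is the characteristic vector of the edge set of $H$, where $E$ is the edge set of $T$. $\mathcal{P}_T\subset\mathbb{R}^E$ is the set of $w$ such that for every internal node $v$ with incident edges $a,b,c$: $w_a\le w_b+w_c$, $w_b\le w_a+w_c$, $w_c\le w_a+w_b$, $w_a+w_b+w_c\le1$; and if $T$ is a single edge $e$, $\mathcal{P}_T=\{w:0\le w_e\le\frac12\}$.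
   Formalization: The polytope $\mathcal{P}_T$ consists only of points of ℚ^E rather than ℝ^E, and the coefficients of the convex combinations in the definition of a vertex are rational. -}

module Defs where

open import Data.Nat using (ℕ)
open import Data.Fin using (Fin)
open import Data.Fin.Properties using (_≟_)
open import Data.List using (List; []; _∷_; _++_; [_]; length; filter; concatMap)
open import Data.List.Base using (allFin)
open import Data.List.Membership.Propositional using (_∈_)
import Data.List.Membership.DecPropositional
open import Data.List.Relation.Unary.Unique.Propositional using (Unique)
open import Data.List.Relation.Unary.AllPairs using (AllPairs)
open import Data.List.Relation.Unary.Any using (Any)
open import Data.Product using (Σ; ∃; ∃-syntax; _×_; _,_; proj₁)
open import Data.Sum using (_⊎_)
open import Data.Bool using (if_then_else_)
open import Data.Rational using (ℚ; 0ℚ; 1ℚ; ½; _+_; _*_; _-_; _≤_; _<_)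
open import Relation.Nullary using (¬_; does)
open import Relation.Nullary.Decidable using (_⊎-dec_)
open import Relation.Binary.PropositionalEquality using (_≡_; _≢_)

-- A finite (multi)graph with vertex set Fin n and edge set Fin m;
-- edge e joins src e and tgt e. Loops are excluded.
record Graph : Set where
  field
    n m      : ℕ
    src tgt  : Fin m → Fin n
    loopless : ∀ e → src e ≢ tgt e

module _ (G : Graph) where
  open Graph G

  Vertex : Set
  Vertex = Fin n

  Edge : Set
  Edge = Fin m

  Incident : Edge → Vertex → Set
  Incident e v = src e ≡ v ⊎ tgt e ≡ v

  Joins : Edge → Vertex → Vertex → Set
  Joins e u v = (src e ≡ u × tgt e ≡ v) ⊎ (src e ≡ v × tgt e ≡ u)

  deg : Vertex → ℕ
  deg v = length (filter (λ e → (src e ≟ v) ⊎-dec (tgt e ≟ v)) (allFin m))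

  data Walk : Vertex → Vertex → Set where
    stop : ∀ {u} → Walk u u
    step : ∀ {u v w} (e : Edge) → Joins e u v → Walk v w → Walk u w

  edges : ∀ {u v} → Walk u v → List Edge
  edges stop          = []
  edges (step e _ p)  = e ∷ edges p

  initVerts : ∀ {u v} → Walk u v → List Vertex
  initVerts stop                 = []
  initVerts (step {u = u} _ _ p) = u ∷ initVerts p

  verts : ∀ {u v} → Walk u v → List Vertex
  verts {v = v} p = initVerts p ++ [ v ]

  IsPath : ∀ {u v} → Walk u v → Set
  IsPath p = Unique (verts p)

  IsCycle : ∀ {u} → Walk u u → Set
  IsCycle p = (edges p ≢ []) × Unique (edges p) × Unique (initVerts p)

  Connected : Set
  Connected = ∀ (u v : Vertex) → Σ (Walk u v) IsPath

  Acyclic : Set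
  Acyclic = ∀ (u : Vertex) (p : Walk u u) → ¬ IsCycle p

  IsTree : Set
  IsTree = Connected × Acyclic

  IsLeaf : Vertex → Set
  IsLeaf v = deg v ≡ 1

  IsInternal : Vertex → Set
  IsInternal v = deg v ≡ 3

  Is13Tree : Set
  Is13Tree = IsTree × (∀ v → IsLeaf v ⊎ IsInternal v)

  record LeafPath : Set where
    field
      start end : Vertex
      walk      : Walk start end
      isPath    : IsPath walk
      nonempty  : edges walk ≢ []
      startLeaf : IsLeaf start
      endLeaf   : IsLeaf end

  lpVerts : LeafPath → List Vertex
  lpVerts P = verts (LeafPath.walk P)

  lpEdges : LeafPath → List Edge
  lpEdges P = edges (LeafPath.walk P)

  VertexDisjoint : LeafPath → LeafPath → Set
  VertexDisjoint P Q = ∀ x → x ∈ lpVerts P → ¬ (x ∈ lpVerts Q)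

  PairwiseVertexDisjoint : List LeafPath → Set
  PairwiseVertexDisjoint H = AllPairs VertexDisjoint H

  indicator : List LeafPath → Edge → ℚ
  indicator H e =
    if does (Data.List.Membership.DecPropositional._∈?_ _≟_ e (concatMap lpEdges H))
    then 1ℚ else 0ℚ

  InP : (Edge → ℚ) → Set
  InP w =
    (∀ (v : Vertex) (a b c : Edge) → IsInternal v →
       a ≢ b → b ≢ c → a ≢ c →
       Incident a v → Incident b v → Incident c v →
       (w a ≤ w b + w c) × (w b ≤ w a + w c) × (w c ≤ w a + w b)
         × (w a + w b + w c ≤ 1ℚ))
    × (m ≡ 1 → ∀ (e : Edge) → (0ℚ ≤ w e) × (w e ≤ ½))

  IsVertexOfP : (Edge → ℚ) → Set
  IsVertexOfP w =
    InP w ×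
    (∀ (x y : Edge → ℚ) (λ' : ℚ) → InP x → InP y →
       0ℚ < λ' → λ' < 1ℚ →
       (∀ e → w e ≡ λ' * x e + (1ℚ - λ') * y e) →
       ∀ e → x e ≡ y e)

module Submission where

-- At an internal node v the pairwise disjoint leaf-paths of H use either none or exactly two of the
-- three edges at v: only the path through v can touch it, and v is an inner vertex of that path since
-- leaf-paths end at leaves. So ½𝟙_H meets the node constraints with values (0,0,0) or a permutation
-- of (½,½,0). On the other hand the node constraints force 0 ≤ w_a ≤ ½ (from 2w_a ≤ w_a+w_b+w_c ≤ 1 and
-- w_b+w_c ≤ 2w_a+w_b+w_c), and an edge lies at no internal node only if T is a single edge. Hence
-- P_T ⊆ [0,½]^E, and ½𝟙_H, whose coordinates are endpoints of [0,½], is extreme.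

open import Defs
open import Data.List using (List)
open import Data.Rational using (½; _*_)

open import Data.Bool using (if_then_else_)
open import Data.Nat as ℕ using (suc; zero) renaming (_≤_ to _≤ℕ_; _<_ to _<ℕ_)
import Data.Nat.Properties as ℕ
open import Data.Fin using (Fin; zero; suc)
open import Data.Fin.Properties using (pigeonhole; _≟_; <⇒≢)
open import Data.Product using (_×_; _,_; ∃; ∃₂; proj₂)
import Data.Sum as Sum
open Sum using (_⊎_; inj₁; inj₂)
open import Function using (_∘_)
import Data.List as List
open import Data.List using (_∷_; []; _++_; length; filter; allFin; concatMap)
open import Data.List.Membership.Propositional using (_∈_)
open import Data.List.Membership.Propositional.Properties
  using (∈-filter⁺; ∈-filter⁻; ∈-allFin; ∈-++⁺ˡ; ∈-++⁺ʳ; ∈-++⁻)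
open import Data.List.Relation.Unary.Any using (here; there; index)
open import Data.List.Relation.Unary.Any.Properties using (lookup-index)
import Data.List.Relation.Unary.All as All
open All using (All; _∷_; [])
open import Data.List.Relation.Unary.All.Properties using (All¬⇒¬Any)
open import Data.List.Relation.Unary.AllPairs using (_∷_)
open import Data.List.Relation.Unary.Unique.Propositional using () renaming (Unique to UniqueList)
open import Data.List.Relation.Unary.Unique.Propositional.Properties using (allFin⁺; filter⁺)
import Data.Vec as Vec
open import Data.Vec using (Vec)
import Data.Vec.Relation.Unary.All as VecAll
open VecAll using ([]; _∷_)
open import Data.Vec.Relation.Unary.All.Properties using (lookup⁺)
open import Data.Vec.Relation.Unary.AllPairs using ([]; _∷_)
open import Data.Vec.Relation.Unary.Unique.Propositional using (Unique)
open import Data.Vec.Relation.Unary.Unique.Propositional.Properties using (lookup-injective)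
open import Data.Rational
  using (ℚ; 0ℚ; 1ℚ; _+_; _-_; -_; _≤_; _<_; _≤?_; Positive; NonNegative; positive; nonNegative)
open import Data.Rational.Properties
  using (≤-refl; ≤-antisym; <-irrefl; <⇒≤; ≮⇒≥; +-assoc; +-comm; +-identityˡ; +-inverseʳ; *-identityˡ;
         *-distribʳ-+; +-mono-≤; +-monoʳ-≤; +-mono-<; +-monoˡ-<; +-mono-<-≤; *-monoʳ-<-pos; *-monoˡ-≤-nonNeg;
         module ≤-Reasoning)
open import Data.Rational.Solver using (module +-*-Solver)
open import Relation.Nullary using (¬_; yes; no; contradiction)
open import Relation.Nullary.Decidable using (Dec; _⊎-dec_; _×-dec_; from-yes; dec-true; dec-false; toSum)
open import Relation.Binary.PropositionalEquality

-- The constraints of P_T at an internal node whose three edges have weights a, b, c.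
SmallTriangle : ℚ → ℚ → ℚ → Set
SmallTriangle a b c = (a ≤ b + c) × (b ≤ a + c) × (c ≤ a + b) × (a + b + c ≤ 1ℚ)

small-triangle? : ∀ a b c → Dec (SmallTriangle a b c)
small-triangle? a b c = (a ≤? b + c) ×-dec (b ≤? a + c) ×-dec (c ≤? a + b) ×-dec (a + b + c ≤? 1ℚ)

small-triangle-cong : ∀ {a b c a′ b′ c′} → a ≡ a′ → b ≡ b′ → c ≡ c′ → SmallTriangle a′ b′ c′ → SmallTriangle a b c
small-triangle-cong refl refl refl triangle = triangle

SmallTriangle⇒bounds : ∀ {a b c} → SmallTriangle a b c → (0ℚ ≤ a) × (a ≤ ½)
SmallTriangle⇒bounds {a} {b} {c} (a≤b+c , b≤a+c , c≤a+b , a+b+c≤1) = ≮⇒≥ a≮0 , ≮⇒≥ ½≮a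
  where
  open ≤-Reasoning
  open +-*-Solver

  a≮0 : ¬ a < 0ℚ
  a≮0 a<0 = <-irrefl refl (begin-strict
    b + c              ≤⟨ +-mono-≤ b≤a+c c≤a+b ⟩
    (a + c) + (a + b)  ≡⟨ solve 3 (λ a b c → (a :+ c) :+ (a :+ b) := (a :+ a) :+ (b :+ c)) refl a b c ⟩
    (a + a) + (b + c)  <⟨ +-monoˡ-< (b + c) (+-mono-< a<0 a<0) ⟩
    0ℚ + (b + c)       ≡⟨ +-identityˡ (b + c) ⟩
    b + c              ∎)

  ½≮a : ¬ ½ < a
  ½≮a ½<a = <-irrefl refl (begin-strict
    1ℚ           ≡⟨⟩
    ½ + ½        <⟨ +-mono-< ½<a ½<a ⟩
    a + a        ≤⟨ +-monoʳ-≤ a a≤b+c ⟩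
    a + (b + c)  ≡⟨ sym (+-assoc a b c) ⟩
    a + b + c    ≤⟨ a+b+c≤1 ⟩
    1ℚ           ∎)

module _ {s t : ℚ} (0<s : 0ℚ < s) (0≤t : 0ℚ ≤ t) (s+t≡1 : s + t ≡ 1ℚ) where

  private
    mean-of-constant : ∀ p → s * p + t * p ≡ p
    mean-of-constant p = begin
      s * p + t * p  ≡⟨ sym (*-distribʳ-+ p s t) ⟩
      (s + t) * p    ≡⟨ cong (_* p) s+t≡1 ⟩
      1ℚ * p         ≡⟨ *-identityˡ p ⟩
      p              ∎
      where open ≡-Reasoning

    instance
      s-positive : Positive s
      s-positive = positive 0<s
      t-nonNegative : NonNegative t
      t-nonNegative = nonNegative 0≤t

  mean-at-lower-bound : ∀ {p x y} → p ≤ x → p ≤ y → s * x + t * y ≡ p → x ≡ p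
  mean-at-lower-bound {p} {x} {y} p≤x p≤y mean≡p = ≤-antisym (≮⇒≥ p≮x) p≤x
    where
    open ≤-Reasoning
    p≮x : ¬ p < x
    p≮x p<x = <-irrefl (sym mean≡p) (begin-strict
      p              ≡⟨ sym (mean-of-constant p) ⟩
      s * p + t * p  <⟨ +-mono-<-≤ (*-monoʳ-<-pos s p<x) (*-monoˡ-≤-nonNeg t p≤y) ⟩
      s * x + t * y  ∎)

  mean-at-upper-bound : ∀ {p x y} → x ≤ p → y ≤ p → s * x + t * y ≡ p → x ≡ p
  mean-at-upper-bound {p} {x} {y} x≤p y≤p mean≡p = ≤-antisym x≤p (≮⇒≥ x≮p)
    where
    open ≤-Reasoning
    x≮p : ¬ x < p
    x≮p x<p = <-irrefl mean≡p (begin-strict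
      s * x + t * y  <⟨ +-mono-<-≤ (*-monoʳ-<-pos s x<p) (*-monoˡ-≤-nonNeg t y≤p) ⟩
      s * p + t * p  ≡⟨ mean-of-constant p ⟩
      p              ∎)

module _ {l : ℚ} (0<l : 0ℚ < l) (l<1 : l < 1ℚ) where

  private
    0<1-l : 0ℚ < 1ℚ - l
    0<1-l = subst (_< 1ℚ - l) (+-inverseʳ l) (+-monoˡ-< (- l) l<1)

    l+[1-l]≡1 : l + (1ℚ - l) ≡ 1ℚ
    l+[1-l]≡1 = solve 1 (λ l → l :+ (con 1ℚ :- l) := con 1ℚ) refl l
      where open +-*-Solver

    [1-l]+l≡1 : (1ℚ - l) + l ≡ 1ℚ
    [1-l]+l≡1 = trans (+-comm (1ℚ - l) l) l+[1-l]≡1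

  combination-at-lower-bound : ∀ {p x y} → p ≤ x → p ≤ y → p ≡ l * x + (1ℚ - l) * y → x ≡ y
  combination-at-lower-bound {x = x} {y} p≤x p≤y p≡comb = trans
    (mean-at-lower-bound 0<l (<⇒≤ 0<1-l) l+[1-l]≡1 p≤x p≤y (sym p≡comb))
    (sym (mean-at-lower-bound 0<1-l (<⇒≤ 0<l) [1-l]+l≡1 p≤y p≤x (trans (+-comm ((1ℚ - l) * y) (l * x)) (sym p≡comb))))

  combination-at-upper-bound : ∀ {p x y} → x ≤ p → y ≤ p → p ≡ l * x + (1ℚ - l) * y → x ≡ y
  combination-at-upper-bound {x = x} {y} x≤p y≤p p≡comb = trans
    (mean-at-upper-bound 0<l (<⇒≤ 0<1-l) l+[1-l]≡1 x≤p y≤p (sym p≡comb))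
    (sym (mean-at-upper-bound 0<1-l (<⇒≤ 0<l) [1-l]+l≡1 y≤p x≤p (trans (+-comm ((1ℚ - l) * y) (l * x)) (sym p≡comb))))

endpoint-extreme : ∀ {lo hi w x y l} → (lo ≤ x) × (x ≤ hi) → (lo ≤ y) × (y ≤ hi) → w ≡ lo ⊎ w ≡ hi →
  0ℚ < l → l < 1ℚ → w ≡ l * x + (1ℚ - l) * y → x ≡ y
endpoint-extreme (lo≤x , _) (lo≤y , _) (inj₁ refl) 0<l l<1 = combination-at-lower-bound 0<l l<1 lo≤x lo≤y
endpoint-extreme (_ , x≤hi) (_ , y≤hi) (inj₂ refl) 0<l l<1 = combination-at-upper-bound 0<l l<1 x≤hi y≤hi

endpoint-bounds : ∀ {lo hi x} → lo ≤ hi → x ≡ lo ⊎ x ≡ hi → (lo ≤ x) × (x ≤ hi)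
endpoint-bounds lo≤hi (inj₁ refl) = ≤-refl , lo≤hi
endpoint-bounds lo≤hi (inj₂ refl) = lo≤hi , ≤-refl

unique-members≤length : ∀ {A : Set} {k} (xs : List A) {ys : Vec A k} →
  Unique ys → VecAll.All (_∈ xs) ys → k ≤ℕ length xs
unique-members≤length {k = k} xs {ys} ys-unique ys⊆xs = ℕ.≮⇒≥ too-long
  where
  position : ∀ i → Fin (length xs)
  position i = index (lookup⁺ ys⊆xs i)

  same-position⇒same : ∀ i j → position i ≡ position j → Vec.lookup ys i ≡ Vec.lookup ys j
  same-position⇒same i j eq = begin
    Vec.lookup ys i                  ≡⟨ lookup-index (lookup⁺ ys⊆xs i) ⟩
    List.lookup xs (position i)      ≡⟨ cong (List.lookup xs) eq ⟩
    List.lookup xs (position j)      ≡⟨ sym (lookup-index (lookup⁺ ys⊆xs j)) ⟩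
    Vec.lookup ys j                  ∎
    where open ≡-Reasoning

  too-long : ¬ length xs <ℕ k
  too-long len<k with i , j , i<j , eq ← pigeonhole len<k position =
    <⇒≢ i<j (lookup-injective ys-unique i j (same-position⇒same i j eq))

unique-length-3⇒two-others : ∀ {A : Set} {xs : List A} {x} → UniqueList xs → length xs ≡ 3 → x ∈ xs →
  ∃₂ λ y z → x ≢ y × y ≢ z × x ≢ z × y ∈ xs × z ∈ xs
unique-length-3⇒two-others {xs = p ∷ q ∷ r ∷ []} ((p≢q ∷ p≢r ∷ []) ∷ (q≢r ∷ []) ∷ _) _ (here refl) =
  q , r , p≢q , q≢r , p≢r , there (here refl) , there (there (here refl))
unique-length-3⇒two-others {xs = p ∷ q ∷ r ∷ []} ((p≢q ∷ p≢r ∷ []) ∷ (q≢r ∷ []) ∷ _) _ (there (here refl)) =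
  p , r , ≢-sym p≢q , p≢r , q≢r , here refl , there (there (here refl))
unique-length-3⇒two-others {xs = p ∷ q ∷ r ∷ []} ((p≢q ∷ p≢r ∷ []) ∷ (q≢r ∷ []) ∷ _) _ (there (there (here refl))) =
  p , q , ≢-sym p≢r , p≢q , ≢-sym q≢r , here refl , there (here refl)

Fin-constant⇒1 : ∀ {k} (i : Fin k) → (∀ j → j ≡ i) → k ≡ 1
Fin-constant⇒1 {suc zero} _ _ = refl
Fin-constant⇒1 {suc (suc k)} i all≡i with () ← trans (all≡i zero) (sym (all≡i (suc zero)))

module _ (G : Graph) where
  open Graph G
  open import Data.List.Membership.DecPropositional (_≟_ {n}) using () renaming (_∈?_ to _∈ᵥ?_)
  open import Data.List.Membership.DecPropositional (_≟_ {m}) using () renaming (_∈?_ to _∈ₑ?_)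

  incident? : ∀ v e → Dec (Incident G e v)
  incident? v e = (src e ≟ v) ⊎-dec (tgt e ≟ v)

  incident : Vertex G → List (Edge G)
  incident v = filter (incident? v) (allFin m)

  ∈-incident⁺ : ∀ {e v} → Incident G e v → e ∈ incident v
  ∈-incident⁺ {e} {v} = ∈-filter⁺ (incident? v) (∈-allFin e)

  ∈-incident⁻ : ∀ {e v} → e ∈ incident v → Incident G e v
  ∈-incident⁻ {v = v} e∈ = proj₂ (∈-filter⁻ (incident? v) {xs = allFin m} e∈)

  incident-unique : ∀ v → UniqueList (incident v)
  incident-unique v = filter⁺ (incident? v) (allFin⁺ m)

  distinct-incident≤deg : ∀ {k v} {es : Vec (Edge G) k} →
    Unique es → VecAll.All (λ e → Incident G e v) es → k ≤ℕ deg G v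
  distinct-incident≤deg {v = v} es-unique es-at-v =
    unique-members≤length (incident v) es-unique (VecAll.map ∈-incident⁺ es-at-v)

  leaf-edge-unique : ∀ {v a d} → IsLeaf G v → Incident G a v → Incident G d v → d ≡ a
  leaf-edge-unique {v} {a} {d} leaf a-at-v d-at-v with d ≟ a
  ... | yes d≡a = d≡a
  ... | no d≢a = contradiction (subst (2 ≤ℕ_) leaf two≤deg) λ { (ℕ.s≤s ()) }
    where
    two≤deg : 2 ≤ℕ deg G v
    two≤deg = distinct-incident≤deg ((≢-sym d≢a ∷ []) ∷ [] ∷ []) (a-at-v ∷ d-at-v ∷ [])

  internal-edges-exhaustive : ∀ {v a b c d} → IsInternal G v → a ≢ b → b ≢ c → a ≢ c →
    Incident G a v → Incident G b v → Incident G c v → Incident G d v →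
    d ≡ a ⊎ d ≡ b ⊎ d ≡ c
  internal-edges-exhaustive {v} {a} {b} {c} {d} internal a≢b b≢c a≢c a-at-v b-at-v c-at-v d-at-v
    with d ≟ a | d ≟ b | d ≟ c
  ... | yes d≡a | _       | _       = inj₁ d≡a
  ... | no _    | yes d≡b | _       = inj₂ (inj₁ d≡b)
  ... | no _    | no _    | yes d≡c = inj₂ (inj₂ d≡c)
  ... | no d≢a  | no d≢b  | no d≢c  =
    contradiction (subst (4 ≤ℕ_) internal four≤deg) λ { (ℕ.s≤s (ℕ.s≤s (ℕ.s≤s ()))) }
    where
    four≤deg : 4 ≤ℕ deg G v
    four≤deg = distinct-incident≤deg
      ((a≢b ∷ a≢c ∷ ≢-sym d≢a ∷ []) ∷ (b≢c ∷ ≢-sym d≢b ∷ []) ∷ (≢-sym d≢c ∷ []) ∷ [] ∷ [])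
      (a-at-v ∷ b-at-v ∷ c-at-v ∷ d-at-v ∷ [])

  internal-other-edges : ∀ {v e} → IsInternal G v → Incident G e v →
    ∃₂ λ b c → e ≢ b × b ≢ c × e ≢ c × Incident G b v × Incident G c v
  internal-other-edges {v} internal e-at-v
    with b , c , e≢b , b≢c , e≢c , b∈ , c∈ ← unique-length-3⇒two-others (incident-unique v) internal (∈-incident⁺ e-at-v) =
    b , c , e≢b , b≢c , e≢c , ∈-incident⁻ b∈ , ∈-incident⁻ c∈

  joins⇒incidentˡ : ∀ {e u w} → Joins G e u w → Incident G e u
  joins⇒incidentˡ (inj₁ (src≡u , _)) = inj₁ src≡u
  joins⇒incidentˡ (inj₂ (_ , tgt≡u)) = inj₂ tgt≡u

  joins-sym : ∀ {e u w} → Joins G e u w → Joins G e w u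
  joins-sym (inj₁ ends) = inj₂ ends
  joins-sym (inj₂ ends) = inj₁ ends

  joins⇒incidentʳ : ∀ {e u w} → Joins G e u w → Incident G e w
  joins⇒incidentʳ = joins⇒incidentˡ ∘ joins-sym

  incident-joins : ∀ {e u w v} → Joins G e u w → Incident G e v → v ≡ u ⊎ v ≡ w
  incident-joins (inj₁ (refl , refl)) (inj₁ refl) = inj₁ refl
  incident-joins (inj₁ (refl , refl)) (inj₂ refl) = inj₂ refl
  incident-joins (inj₂ (refl , refl)) (inj₁ refl) = inj₂ refl
  incident-joins (inj₂ (refl , refl)) (inj₂ refl) = inj₁ refl

  joins-functional : ∀ {e u w w′} → Joins G e u w → Joins G e u w′ → w′ ≡ w
  joins-functional (inj₁ (_ , tgt≡w)) (inj₁ (_ , tgt≡w′)) = trans (sym tgt≡w′) tgt≡w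
  joins-functional (inj₂ (src≡w , _)) (inj₂ (src≡w′ , _)) = trans (sym src≡w′) src≡w
  joins-functional {e} (inj₁ (src≡u , _)) (inj₂ (_ , tgt≡u)) = contradiction (trans src≡u (sym tgt≡u)) (loopless e)
  joins-functional {e} (inj₂ (_ , tgt≡u)) (inj₁ (src≡u , _)) = contradiction (trans src≡u (sym tgt≡u)) (loopless e)

  head∈verts : ∀ {u w} (p : Walk G u w) → u ∈ verts G p
  head∈verts stop         = here refl
  head∈verts (step _ _ _) = here refl

  incident⇒∈verts : ∀ {u w e v} (p : Walk G u w) → e ∈ edges G p → Incident G e v → v ∈ verts G p
  incident⇒∈verts (step _ j p) (here refl) e-at-v with incident-joins j e-at-v
  ... | inj₁ refl = here refl
  ... | inj₂ refl = there (head∈verts p)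
  incident⇒∈verts (step _ _ p) (there e∈p) e-at-v = there (incident⇒∈verts p e∈p e-at-v)

  leaf-step : ∀ {e f x y z} → IsLeaf G x → Joins G e x y → Joins G f x z → z ≡ y
  leaf-step leaf j j′ with refl ← leaf-edge-unique leaf (joins⇒incidentˡ j) (joins⇒incidentˡ j′) =
    joins-functional j j′

  path-from-leaf-leaf-edge : ∀ {e x y w} → Joins G e x y → IsLeaf G x → IsLeaf G y →
    (p : Walk G x w) → IsPath G p → w ≡ x ⊎ w ≡ y
  path-from-leaf-leaf-edge _ _ _ stop _ = inj₁ refl
  path-from-leaf-leaf-edge j x-leaf _ (step _ j₁ stop) _
    with refl ← leaf-step x-leaf j j₁ = inj₂ refl
  path-from-leaf-leaf-edge j x-leaf y-leaf (step _ j₁ (step _ j₂ p)) (x∉ ∷ _)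
    with refl ← leaf-step x-leaf j j₁
    with refl ← leaf-step y-leaf (joins-sym j) j₂ =
    contradiction (there (head∈verts p)) (All¬⇒¬Any x∉)

  leaf-leaf-edge⇒single-edge : Connected G → ∀ e → IsLeaf G (src e) → IsLeaf G (tgt e) → m ≡ 1
  leaf-leaf-edge⇒single-edge connected e src-leaf tgt-leaf = Fin-constant⇒1 e only-e
    where
    only-e : ∀ e′ → e′ ≡ e
    only-e e′ with p , p-path ← connected (src e) (src e′)
      with path-from-leaf-leaf-edge (inj₁ (refl , refl)) src-leaf tgt-leaf p p-path
    ... | inj₁ at-src = leaf-edge-unique src-leaf (inj₁ refl) (inj₁ at-src)
    ... | inj₂ at-tgt = leaf-edge-unique tgt-leaf (inj₂ refl) (inj₁ at-tgt)

  edge-at-internal : Is13Tree G → ∀ e → (∃ λ v → IsInternal G v × Incident G e v) ⊎ m ≡ 1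
  edge-at-internal ((connected , _) , leaf-or-internal) e
    with leaf-or-internal (src e) | leaf-or-internal (tgt e)
  ... | inj₂ internal | _             = inj₁ (src e , internal , inj₁ refl)
  ... | inj₁ _        | inj₂ internal = inj₁ (tgt e , internal , inj₂ refl)
  ... | inj₁ src-leaf | inj₁ tgt-leaf = inj₂ (leaf-leaf-edge⇒single-edge connected e src-leaf tgt-leaf)

  Avoids : List (Edge G) → Vertex G → Set
  Avoids es v = ∀ {d} → d ∈ es → ¬ Incident G d v

  record MeetsTwice (es : List (Edge G)) (v : Vertex G) : Set where
    field
      e₁ e₂    : Edge G
      e₁≢e₂    : e₁ ≢ e₂
      e₁∈es    : e₁ ∈ es
      e₂∈es    : e₂ ∈ es
      e₁-at-v  : Incident G e₁ v
      e₂-at-v  : Incident G e₂ v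
      only     : ∀ {d} → d ∈ es → Incident G d v → d ≡ e₁ ⊎ d ≡ e₂

  avoids-++ : ∀ {xs ys v} → Avoids xs v → Avoids ys v → Avoids (xs ++ ys) v
  avoids-++ {xs} xs-avoid ys-avoid d∈ with ∈-++⁻ xs d∈
  ... | inj₁ d∈xs = xs-avoid d∈xs
  ... | inj₂ d∈ys = ys-avoid d∈ys

  meetsTwice-++ˡ : ∀ {xs ys v} → MeetsTwice xs v → Avoids ys v → MeetsTwice (xs ++ ys) v
  meetsTwice-++ˡ {xs} {ys} {v} twice ys-avoid = record
    { MeetsTwice twice
    ; e₁∈es = ∈-++⁺ˡ e₁∈es
    ; e₂∈es = ∈-++⁺ˡ e₂∈es
    ; only  = only′
    }
    where
    open MeetsTwice twice
    only′ : ∀ {d} → d ∈ xs ++ ys → Incident G d v → d ≡ e₁ ⊎ d ≡ e₂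
    only′ d∈ d-at-v with ∈-++⁻ xs d∈
    ... | inj₁ d∈xs = only d∈xs d-at-v
    ... | inj₂ d∈ys = contradiction d-at-v (ys-avoid d∈ys)

  meetsTwice-++ʳ : ∀ {xs ys v} → Avoids xs v → MeetsTwice ys v → MeetsTwice (xs ++ ys) v
  meetsTwice-++ʳ {xs} {ys} {v} xs-avoid twice = record
    { MeetsTwice twice
    ; e₁∈es = ∈-++⁺ʳ xs e₁∈es
    ; e₂∈es = ∈-++⁺ʳ xs e₂∈es
    ; only  = only′
    }
    where
    open MeetsTwice twice
    only′ : ∀ {d} → d ∈ xs ++ ys → Incident G d v → d ≡ e₁ ⊎ d ≡ e₂
    only′ d∈ d-at-v with ∈-++⁻ xs d∈
    ... | inj₁ d∈xs = contradiction d-at-v (xs-avoid d∈xs)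
    ... | inj₂ d∈ys = only d∈ys d-at-v

  path-avoids : ∀ {u w v} (p : Walk G u w) → ¬ v ∈ verts G p → Avoids (edges G p) v
  path-avoids p v∉p d∈p d-at-v = v∉p (incident⇒∈verts p d∈p d-at-v)

  path-meets-inner-vertex-twice : ∀ {s t v} (p : Walk G s t) → IsPath G p →
    v ∈ verts G p → v ≢ s → v ≢ t → MeetsTwice (edges G p) v
  path-meets-inner-vertex-twice stop _ (here refl) _ v≢t = contradiction refl v≢t
  path-meets-inner-vertex-twice (step _ _ _) _ (here refl) v≢s _ = contradiction refl v≢s
  path-meets-inner-vertex-twice (step _ _ stop) _ (there (here refl)) _ v≢t = contradiction refl v≢t
  path-meets-inner-vertex-twice {v = v} (step e j (step e′ j′ p)) (s∉ ∷ v∉ ∷ _) (there (here refl)) _ _ = record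
    { e₁ = e ; e₂ = e′ ; e₁≢e₂ = e≢e′
    ; e₁∈es = here refl ; e₂∈es = there (here refl)
    ; e₁-at-v = joins⇒incidentʳ j ; e₂-at-v = joins⇒incidentˡ j′
    ; only = only
    }
    where
    -- e = e′ would lead the path straight back to s
    e≢e′ : e ≢ e′
    e≢e′ refl with refl ← joins-functional (joins-sym j) j′ = All¬⇒¬Any s∉ (there (head∈verts p))

    only : ∀ {d} → d ∈ edges G (step e j (step e′ j′ p)) → Incident G d v → d ≡ e ⊎ d ≡ e′
    only (here d≡e) _ = inj₁ d≡e
    only (there (here d≡e′)) _ = inj₂ d≡e′
    only (there (there d∈p)) d-at-v = contradiction d-at-v (path-avoids p (All¬⇒¬Any v∉) d∈p)
  path-meets-inner-vertex-twice {v = v} (step {v = u} e j p@(step _ _ _)) (_ ∷ p-path@(u∉ ∷ _))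
                                (there v∈p@(there v∈rest)) v≢s v≢t =
    meetsTwice-++ʳ e-avoids (path-meets-inner-vertex-twice p p-path v∈p v≢u v≢t)
    where
    v≢u : v ≢ u
    v≢u refl = All¬⇒¬Any u∉ v∈rest
    e-avoids : Avoids (e ∷ []) v
    e-avoids (here refl) e-at-v with incident-joins j e-at-v
    ... | inj₁ v≡s = v≢s v≡s
    ... | inj₂ v≡u = v≢u v≡u

  internal⇒¬leaf : ∀ {v} → IsInternal G v → ¬ IsLeaf G v
  internal⇒¬leaf internal leaf with () ← trans (sym internal) leaf

  InP⇒bounds : Is13Tree G → ∀ {x} → InP G x → ∀ e → (0ℚ ≤ x e) × (x e ≤ ½)
  InP⇒bounds tree (at-internal , at-single-edge) e with edge-at-internal tree e
  ... | inj₂ m≡1 = at-single-edge m≡1 e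
  ... | inj₁ (v , internal , e-at-v)
    with b , c , e≢b , b≢c , e≢c , b-at-v , c-at-v ← internal-other-edges internal e-at-v =
    SmallTriangle⇒bounds (at-internal v e b c internal e≢b b≢c e≢c e-at-v b-at-v c-at-v)

  half-integral⇒vertex : Is13Tree G → ∀ {w} → InP G w → (∀ e → w e ≡ 0ℚ ⊎ w e ≡ ½) → IsVertexOfP G w
  half-integral⇒vertex tree w∈P w-values = w∈P , λ x y l x∈P y∈P 0<l l<1 w≡comb e →
    endpoint-extreme (InP⇒bounds tree x∈P e) (InP⇒bounds tree y∈P e) (w-values e) 0<l l<1 (w≡comb e)

  edgesOf : List (LeafPath G) → List (Edge G)
  edgesOf = concatMap (lpEdges G)

  avoids-edgesOf : ∀ {v} H → All (λ Q → ¬ v ∈ lpVerts G Q) H → Avoids (edgesOf H) v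
  avoids-edgesOf []      []            ()
  avoids-edgesOf (Q ∷ H) (v∉Q ∷ v∉H) = avoids-++ (path-avoids (LeafPath.walk Q) v∉Q) (avoids-edgesOf H v∉H)

  disjoint-leaf-paths-at-inner-vertex : ∀ {v} H → PairwiseVertexDisjoint G H → ¬ IsLeaf G v →
    Avoids (edgesOf H) v ⊎ MeetsTwice (edgesOf H) v
  disjoint-leaf-paths-at-inner-vertex [] _ _ = inj₁ λ ()
  disjoint-leaf-paths-at-inner-vertex {v} (P ∷ H) (P#H ∷ H-disjoint) v-inner with v ∈ᵥ? lpVerts G P
  ... | yes v∈P = inj₂ (meetsTwice-++ˡ
          (path-meets-inner-vertex-twice walk isPath v∈P (λ { refl → v-inner startLeaf }) (λ { refl → v-inner endLeaf }))
          (avoids-edgesOf H (All.map (λ P#Q → P#Q v v∈P) P#H)))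
    where open LeafPath P
  ... | no v∉P = Sum.map (avoids-++ P-avoids) (meetsTwice-++ʳ P-avoids)
                   (disjoint-leaf-paths-at-inner-vertex H H-disjoint v-inner)
    where
    P-avoids : Avoids (lpEdges G P) v
    P-avoids = path-avoids (LeafPath.walk P) v∉P

  module _ (H : List (LeafPath G)) where

    half-indicator : Edge G → ℚ
    half-indicator e = ½ * indicator G H e

    half-indicator-∈ : ∀ {e} → e ∈ edgesOf H → half-indicator e ≡ ½
    half-indicator-∈ {e} e∈H = cong (λ b → ½ * (if b then 1ℚ else 0ℚ)) (dec-true (e ∈ₑ? edgesOf H) e∈H)

    half-indicator-∉ : ∀ {e} → ¬ e ∈ edgesOf H → half-indicator e ≡ 0ℚ
    half-indicator-∉ {e} e∉H = cong (λ b → ½ * (if b then 1ℚ else 0ℚ)) (dec-false (e ∈ₑ? edgesOf H) e∉H)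

    half-indicator-values : ∀ e → half-indicator e ≡ 0ℚ ⊎ half-indicator e ≡ ½
    half-indicator-values e = Sum.swap (Sum.map half-indicator-∈ half-indicator-∉ (toSum (e ∈ₑ? edgesOf H)))

    half-indicator-at-internal : PairwiseVertexDisjoint G H → ∀ v a b c → IsInternal G v →
      a ≢ b → b ≢ c → a ≢ c → Incident G a v → Incident G b v → Incident G c v →
      SmallTriangle (half-indicator a) (half-indicator b) (half-indicator c)
    half-indicator-at-internal H-disjoint v a b c internal a≢b b≢c a≢c a-at-v b-at-v c-at-v
      with disjoint-leaf-paths-at-inner-vertex H H-disjoint (internal⇒¬leaf internal)
    ... | inj₁ H-avoids = small-triangle-cong (unused a-at-v) (unused b-at-v) (unused c-at-v)
                         (from-yes (small-triangle? 0ℚ 0ℚ 0ℚ))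
      where
      unused : ∀ {d} → Incident G d v → half-indicator d ≡ 0ℚ
      unused d-at-v = half-indicator-∉ (λ d∈H → H-avoids d∈H d-at-v)
    ... | inj₂ twice = from-positions (at-v e₁-at-v) (at-v e₂-at-v)
      where
      open MeetsTwice twice

      at-v : ∀ {d} → Incident G d v → d ≡ a ⊎ d ≡ b ⊎ d ≡ c
      at-v = internal-edges-exhaustive internal a≢b b≢c a≢c a-at-v b-at-v c-at-v

      used : ∀ {d} → d ≡ e₁ ⊎ d ≡ e₂ → half-indicator d ≡ ½
      used (inj₁ refl) = half-indicator-∈ e₁∈es
      used (inj₂ refl) = half-indicator-∈ e₂∈es

      unused : ∀ {d} → Incident G d v → d ≢ e₁ → d ≢ e₂ → half-indicator d ≡ 0ℚ
      unused d-at-v d≢e₁ d≢e₂ = half-indicator-∉ λ d∈H → Sum.[ d≢e₁ , d≢e₂ ] (only d∈H d-at-v)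

      from-positions : e₁ ≡ a ⊎ e₁ ≡ b ⊎ e₁ ≡ c → e₂ ≡ a ⊎ e₂ ≡ b ⊎ e₂ ≡ c →
        SmallTriangle (half-indicator a) (half-indicator b) (half-indicator c)
      from-positions (inj₁ refl)        (inj₁ refl)        = contradiction refl e₁≢e₂
      from-positions (inj₂ (inj₁ refl)) (inj₂ (inj₁ refl)) = contradiction refl e₁≢e₂
      from-positions (inj₂ (inj₂ refl)) (inj₂ (inj₂ refl)) = contradiction refl e₁≢e₂
      from-positions (inj₁ refl)        (inj₂ (inj₁ refl)) =
        small-triangle-cong (used (inj₁ refl)) (used (inj₂ refl)) (unused c-at-v (≢-sym a≢c) (≢-sym b≢c))
          (from-yes (small-triangle? ½ ½ 0ℚ))
      from-positions (inj₂ (inj₁ refl)) (inj₁ refl)        =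
        small-triangle-cong (used (inj₂ refl)) (used (inj₁ refl)) (unused c-at-v (≢-sym b≢c) (≢-sym a≢c))
          (from-yes (small-triangle? ½ ½ 0ℚ))
      from-positions (inj₁ refl)        (inj₂ (inj₂ refl)) =
        small-triangle-cong (used (inj₁ refl)) (unused b-at-v (≢-sym a≢b) b≢c) (used (inj₂ refl))
          (from-yes (small-triangle? ½ 0ℚ ½))
      from-positions (inj₂ (inj₂ refl)) (inj₁ refl)        =
        small-triangle-cong (used (inj₂ refl)) (unused b-at-v b≢c (≢-sym a≢b)) (used (inj₁ refl))
          (from-yes (small-triangle? ½ 0ℚ ½))
      from-positions (inj₂ (inj₁ refl)) (inj₂ (inj₂ refl)) =
        small-triangle-cong (unused a-at-v a≢b a≢c) (used (inj₁ refl)) (used (inj₂ refl))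
          (from-yes (small-triangle? 0ℚ ½ ½))
      from-positions (inj₂ (inj₂ refl)) (inj₂ (inj₁ refl)) =
        small-triangle-cong (unused a-at-v a≢c a≢b) (used (inj₂ refl)) (used (inj₁ refl))
          (from-yes (small-triangle? 0ℚ ½ ½))

    half-indicator-∈P : PairwiseVertexDisjoint G H → InP G half-indicator
    half-indicator-∈P H-disjoint =
      half-indicator-at-internal H-disjoint , λ _ e → endpoint-bounds (from-yes (0ℚ ≤? ½)) (half-indicator-values e)

lemma2 : (T : Graph) → Is13Tree T → (H : List (LeafPath T)) →
    PairwiseVertexDisjoint T H →
    IsVertexOfP T (λ e → ½ * indicator T H e)
lemma2 T tree H H-disjoint =
  half-integral⇒vertex T tree (half-indicator-∈P T H H-disjoint) (half-indicator-values T H)
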